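{- For every integer $k\ge 0$, the complete graph $K_{k+3}$ has no $(k,2)$-edge co-colouring.
   Context: A $(k,p)$-edge co-colouring of a graph $G$ is an assignment of one of $k$ colours to each edge of $G$ such that no $p$ pairwise disjoint edges (edges whose endpoint sets are pairwise disjoint) all receive the same colour. -}

module Defs where

open import Data.Nat using (ℕ)
open import Data.Fin using (Fin; _<_)
open import Data.Product using (Σ; Σ-syntax; _×_; proj₁; proj₂; _,_)
open import Relation.Binary.PropositionalEquality using (_≡_)
open import Relation.Nullary using (¬_)

record Graph (n : ℕ) : Set₁ where
  field
    Adj : Fin n → Fin n → Set
    sym : ∀ {u v} → Adj u v → Adj v u
    irrefl : ∀ {u} → ¬ Adj u u
open Graph public

-- An edge is recorded as an ordered representative {u,v} with u < v.
Edge : ∀ {n} → Graph n → Set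
Edge {n} G = Σ[ u ∈ Fin n ] Σ[ v ∈ Fin n ] (u < v × Adj G u v)

src tgt : ∀ {n} (G : Graph n) → Edge G → Fin n
src G e = proj₁ e
tgt G e = proj₁ (proj₂ e)

Disjoint : ∀ {n} (G : Graph n) → Edge G → Edge G → Set
Disjoint G e f =
  ¬ (src G e ≡ src G f) × ¬ (src G e ≡ tgt G f)
  × ¬ (tgt G e ≡ src G f) × ¬ (tgt G e ≡ tgt G f)

complete : (n : ℕ) → Graph n
complete n = record
  { Adj = λ u v → ¬ (u ≡ v)
  ; sym = λ u≢v v≡u → u≢v (Relation.Binary.PropositionalEquality.sym v≡u)
  ; irrefl = λ u≢u → u≢u Relation.Binary.PropositionalEquality.refl
  }

IsCoColouring : ∀ {n} (G : Graph n) (k p : ℕ) → (Edge G → Fin k) → Set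
IsCoColouring G k p c =
  ¬ (Σ[ es ∈ (Fin p → Edge G) ] Σ[ col ∈ Fin k ]
       ((∀ i j → ¬ (i ≡ j) → Disjoint G (es i) (es j))
        × (∀ i → c (es i) ≡ col)))

HasCoColouring : ∀ {n} (G : Graph n) (k p : ℕ) → Set
HasCoColouring G k p = Σ[ c ∈ (Edge G → Fin k) ] IsCoColouring G k p c

-- Every colour class of a (k,2)-edge co-colouring is an intersecting family of
-- edges. Among the 2(k+1) edges joining two fixed vertices of K_{k+3} to the
-- other k+1 vertices, some colour occurs three times; since two such edges
-- 0x and 1y of one colour must meet, i.e. x = y, the three edges share an
-- endpoint v, and every edge of that colour, meeting all three, contains v.
-- Deleting v and that colour leaves a (k-1,2)-edge co-colouring of K_{k+2};
-- we end at K_4 with a single colour, where two disjoint edges always clash.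
module Submission where

open import Defs hiding (sym)
open import Data.Nat using (ℕ; zero; suc; _+_; _<_; _≤_; s≤s; z<s)
open import Data.Nat.Properties using (+-comm; +-suc; +-mono-<; m<n⇒m<1+n; n<1+n)
open import Data.Fin using (Fin; zero; suc; punchIn; punchOut; splitAt; join)
open import Data.Fin.Patterns using (0F; 1F; 2F; 3F)
open import Data.Fin.Properties
  using (_≟_; <-cmp; <⇒≢; any?; suc-injective; punchIn-injective; punchInᵢ≢i;
         punchOut-injective; join-splitAt)
open import Data.Product using (Σ-syntax; _×_; _,_)
open import Data.Sum using (_⊎_; inj₁; inj₂; [_,_]′)
import Data.Sum as Sum
open import Data.Empty using (⊥; ⊥-elim)
open import Function using (_∘_; id)
open import Function.Definitions using (Injective)
open import Relation.Nullary using (¬_; yes; no)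
open import Relation.Nullary.Decidable using (¬?; _×-dec_; _⊎-dec_)
open import Relation.Binary.Definitions using (tri<; tri≈; tri>)
open import Relation.Binary.PropositionalEquality
  using (_≡_; _≢_; refl; sym; trans; cong; subst)

record Collision₃ {A B : Set} (f : A → B) : Set where
  constructor collision₃
  field
    x y z : A
    x≢y : x ≢ y
    x≢z : x ≢ z
    y≢z : y ≢ z
    fx≡fy : f x ≡ f y
    fx≡fz : f x ≡ f z

Collision₃-transport : ∀ {A B A′ B′ : Set} {f : A → B} {f′ : A′ → B′}
                       (g : A′ → A) → Injective _≡_ _≡_ g →
                       (∀ {a b} → f′ a ≡ f′ b → f (g a) ≡ f (g b)) →
                       Collision₃ f′ → Collision₃ f
Collision₃-transport g g-injective reflect (collision₃ x y z x≢y x≢z y≢z e₁ e₂) =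
  collision₃ (g x) (g y) (g z)
    (x≢y ∘ g-injective) (x≢z ∘ g-injective) (y≢z ∘ g-injective)
    (reflect e₁) (reflect e₂)

-- Inspect the fibre of f 0 inside the tail: if it has at least two elements we
-- are done; otherwise remove 0 and that fibre, and f 0 from the codomain.
pigeonhole₃ : ∀ {m N} → m + m < N → (f : Fin N → Fin m) → Collision₃ f
pigeonhole₃ {zero} {suc N} _ f with f zero
... | ()
pigeonhole₃ {suc m} {suc (suc N)} (s≤s (s≤s m+1+m≤N)) f
  with any? (λ j → f zero ≟ f (suc j))
... | no f₀-unique =
  Collision₃-transport suc suc-injective
    (punchOut-injective (f₀-unique ∘ (_ ,_)) (f₀-unique ∘ (_ ,_)))
    (pigeonhole₃ (m<n⇒m<1+n m+m<N) (λ j → punchOut (f₀-unique ∘ (j ,_))))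
  where m+m<N = subst (_≤ N) (+-suc m m) m+1+m≤N
... | yes (j , f₀≡fj)
  with any? (λ l → ¬? (l ≟ j) ×-dec (f zero ≟ f (suc l)))
...   | yes (l , l≢j , f₀≡fl) =
  collision₃ zero (suc j) (suc l) (λ ()) (λ ()) (l≢j ∘ sym ∘ suc-injective)
    f₀≡fj f₀≡fl
...   | no no-third =
  Collision₃-transport (suc ∘ punchIn j) (punchIn-injective j _ _ ∘ suc-injective)
    (punchOut-injective (avoids _) (avoids _))
    (pigeonhole₃ (subst (_≤ N) (+-suc m m) m+1+m≤N) (λ l → punchOut (avoids l)))
  where
  avoids : ∀ l → f zero ≢ f (suc (punchIn j l))
  avoids l = no-third ∘ (punchIn j l ,_) ∘ (punchInᵢ≢i j l ,_)

PairColouring : ℕ → ℕ → Set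
PairColouring n k = Fin n → Fin n → Fin k

Meet : ∀ {n} → Fin n → Fin n → Fin n → Fin n → Set
Meet a b c d = a ≡ c ⊎ a ≡ d ⊎ b ≡ c ⊎ b ≡ d

ClassesIntersect : ∀ {n k} → PairColouring n k → Set
ClassesIntersect κ = ∀ {a b c d} → a ≢ b → c ≢ d → κ a b ≡ κ c d → Meet a b c d

Endpoint : ∀ {n} → Fin n → Fin n → Fin n → Set
Endpoint x a b = a ≡ x ⊎ b ≡ x

StarClass : ∀ {n k} → PairColouring n k → Fin k → Fin n → Set
StarClass κ X v = ∀ {a b} → a ≢ b → κ a b ≡ X → Endpoint v a b

Meet-reflect : ∀ {m n} {g : Fin m → Fin n} → Injective _≡_ _≡_ g →
               ∀ {a b c d} → Meet (g a) (g b) (g c) (g d) → Meet a b c d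
Meet-reflect g-injective =
  Sum.map g-injective (Sum.map g-injective (Sum.map g-injective g-injective))

Meet-avoiding : ∀ {n} {a b v w : Fin n} → a ≢ v → b ≢ v →
                Meet a b v w → Endpoint w a b
Meet-avoiding a≢v _   (inj₁ a≡v)               = ⊥-elim (a≢v a≡v)
Meet-avoiding _   _   (inj₂ (inj₁ a≡w))        = inj₁ a≡w
Meet-avoiding _   b≢v (inj₂ (inj₂ (inj₁ b≡v))) = ⊥-elim (b≢v b≡v)
Meet-avoiding _   _   (inj₂ (inj₂ (inj₂ b≡w))) = inj₂ b≡w

pair-has-at-most-two-endpoints : ∀ {n} {a b w₁ w₂ w₃ : Fin n} →
  w₁ ≢ w₂ → w₁ ≢ w₃ → w₂ ≢ w₃ →
  Endpoint w₁ a b → Endpoint w₂ a b → Endpoint w₃ a b → ⊥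
pair-has-at-most-two-endpoints w₁≢w₂ _ _ (inj₁ refl) (inj₁ refl) _ = w₁≢w₂ refl
pair-has-at-most-two-endpoints w₁≢w₂ _ _ (inj₂ refl) (inj₂ refl) _ = w₁≢w₂ refl
pair-has-at-most-two-endpoints _ w₁≢w₃ _ (inj₁ refl) _ (inj₁ refl) = w₁≢w₃ refl
pair-has-at-most-two-endpoints _ w₁≢w₃ _ (inj₂ refl) _ (inj₂ refl) = w₁≢w₃ refl
pair-has-at-most-two-endpoints _ _ w₂≢w₃ _ (inj₁ refl) (inj₁ refl) = w₂≢w₃ refl
pair-has-at-most-two-endpoints _ _ w₂≢w₃ _ (inj₂ refl) (inj₂ refl) = w₂≢w₃ refl

module _ {n k} {κ : PairColouring n k} (intersect : ClassesIntersect κ) where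

  three-spokes⇒StarClass : ∀ {v w₁ w₂ w₃} →
    w₁ ≢ w₂ → w₁ ≢ w₃ → w₂ ≢ w₃ → v ≢ w₁ → v ≢ w₂ → v ≢ w₃ →
    κ v w₁ ≡ κ v w₂ → κ v w₁ ≡ κ v w₃ → StarClass κ (κ v w₁) v
  three-spokes⇒StarClass {v} w₁≢w₂ w₁≢w₃ w₂≢w₃ v≢w₁ v≢w₂ v≢w₃ e₂ e₃ {a} {b} a≢b κab≡X
    with a ≟ v | b ≟ v
  ... | yes a≡v | _       = inj₁ a≡v
  ... | no _    | yes b≡v = inj₂ b≡v
  ... | no a≢v  | no b≢v  =
    ⊥-elim (pair-has-at-most-two-endpoints w₁≢w₂ w₁≢w₃ w₂≢w₃
              (hits v≢w₁ κab≡X) (hits v≢w₂ (trans κab≡X e₂))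
              (hits v≢w₃ (trans κab≡X e₃)))
    where
    hits : ∀ {w} → v ≢ w → κ a b ≡ κ v w → Endpoint w a b
    hits v≢w = Meet-avoiding a≢v b≢v ∘ intersect a≢b v≢w

outer : ∀ {n} → Fin n → Fin (2 + n)
outer i = suc (suc i)

outer-injective : ∀ {n} → Injective _≡_ _≡_ (outer {n})
outer-injective = suc-injective ∘ suc-injective

spoke : ∀ {n k} → PairColouring (2 + n) k → Fin n ⊎ Fin n → Fin k
spoke κ = [ κ 0F ∘ outer , κ 1F ∘ outer ]′

module _ {n k} {κ : PairColouring (2 + n) k} (intersect : ClassesIntersect κ) where

  crossing-spokes-coincide : ∀ {i l} → κ 0F (outer i) ≡ κ 1F (outer l) → i ≡ l
  crossing-spokes-coincide e with intersect (λ ()) (λ ()) e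
  ... | inj₁ ()
  ... | inj₂ (inj₁ ())
  ... | inj₂ (inj₂ (inj₁ ()))
  ... | inj₂ (inj₂ (inj₂ outer-i≡outer-l)) = outer-injective outer-i≡outer-l

  Collision₃-spoke⇒StarClass : Collision₃ (spoke κ) →
                               Σ[ X ∈ Fin k ] Σ[ v ∈ Fin (2 + n) ] StarClass κ X v
  Collision₃-spoke⇒StarClass (collision₃ (inj₁ i) (inj₁ j) (inj₁ l) i≢j i≢l j≢l e₁ e₂) =
    _ , 0F , three-spokes⇒StarClass intersect
               (i≢j ∘ cong inj₁ ∘ outer-injective) (i≢l ∘ cong inj₁ ∘ outer-injective)
               (j≢l ∘ cong inj₁ ∘ outer-injective) (λ ()) (λ ()) (λ ()) e₁ e₂
  Collision₃-spoke⇒StarClass (collision₃ (inj₂ i) (inj₂ j) (inj₂ l) i≢j i≢l j≢l e₁ e₂) =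
    _ , 1F , three-spokes⇒StarClass intersect
               (i≢j ∘ cong inj₂ ∘ outer-injective) (i≢l ∘ cong inj₂ ∘ outer-injective)
               (j≢l ∘ cong inj₂ ∘ outer-injective) (λ ()) (λ ()) (λ ()) e₁ e₂
  -- Mixed sides: both tips on the majority side equal the tip on the other side.
  Collision₃-spoke⇒StarClass (collision₃ (inj₁ i) (inj₁ j) (inj₂ l) i≢j _ _ e₁ e₂) =
    ⊥-elim (i≢j (cong inj₁ (trans (crossing-spokes-coincide e₂)
                                   (sym (crossing-spokes-coincide (trans (sym e₁) e₂))))))
  Collision₃-spoke⇒StarClass (collision₃ (inj₁ i) (inj₂ j) (inj₁ l) _ i≢l _ e₁ e₂) =
    ⊥-elim (i≢l (cong inj₁ (trans (crossing-spokes-coincide e₁)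
                                   (sym (crossing-spokes-coincide (trans (sym e₂) e₁))))))
  Collision₃-spoke⇒StarClass (collision₃ (inj₂ i) (inj₁ j) (inj₁ l) _ _ j≢l e₁ e₂) =
    ⊥-elim (j≢l (cong inj₁ (trans (crossing-spokes-coincide (sym e₁))
                                   (sym (crossing-spokes-coincide (sym e₂))))))
  Collision₃-spoke⇒StarClass (collision₃ (inj₂ i) (inj₂ j) (inj₁ l) i≢j _ _ e₁ e₂) =
    ⊥-elim (i≢j (cong inj₂ (trans (sym (crossing-spokes-coincide (sym e₂)))
                                   (crossing-spokes-coincide (trans (sym e₂) e₁)))))
  Collision₃-spoke⇒StarClass (collision₃ (inj₂ i) (inj₁ j) (inj₂ l) _ i≢l _ e₁ e₂) =
    ⊥-elim (i≢l (cong inj₂ (trans (sym (crossing-spokes-coincide (sym e₁)))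
                                   (crossing-spokes-coincide (trans (sym e₁) e₂)))))
  Collision₃-spoke⇒StarClass (collision₃ (inj₁ i) (inj₂ j) (inj₂ l) _ _ j≢l e₁ e₂) =
    ⊥-elim (j≢l (cong inj₂ (trans (sym (crossing-spokes-coincide e₁))
                                   (crossing-spokes-coincide e₂))))

splitAt-injective : ∀ m {n} → Injective _≡_ _≡_ (splitAt m {n})
splitAt-injective m {n} {x} {y} e =
  trans (sym (join-splitAt m n x)) (trans (cong (join m n) e) (join-splitAt m n y))

StarClass-exists : ∀ {n k} → k < n →
                   (κ : PairColouring (2 + n) k) → ClassesIntersect κ →
                   Σ[ X ∈ Fin k ] Σ[ v ∈ Fin (2 + n) ] StarClass κ X v
StarClass-exists {n} k<n κ intersect =
  Collision₃-spoke⇒StarClass intersect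
    (Collision₃-transport (splitAt n) (splitAt-injective n) id
      (pigeonhole₃ (+-mono-< k<n k<n) (spoke κ ∘ splitAt n)))

module _ {n m} {κ : PairColouring (suc n) (suc (suc m))} (intersect : ClassesIntersect κ)
         {X v} (star : StarClass κ X v) where

  X-avoids-rest : ∀ {a b} → a ≢ b → X ≢ κ (punchIn v a) (punchIn v b)
  X-avoids-rest {a} {b} a≢b X≡κab
    with star (a≢b ∘ punchIn-injective v a b) (sym X≡κab)
  ... | inj₁ a↑≡v = punchInᵢ≢i v a a↑≡v
  ... | inj₂ b↑≡v = punchInᵢ≢i v b b↑≡v

  delete-star : PairColouring n (suc m)
  delete-star a b with a ≟ b
  ... | yes _   = zero
  ... | no a≢b = punchOut (X-avoids-rest a≢b)

  delete-star-intersect : ClassesIntersect delete-star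
  delete-star-intersect {a} {b} {c} {d} a≢b c≢d e with a ≟ b | c ≟ d
  ... | yes a≡b | _       = ⊥-elim (a≢b a≡b)
  ... | no _    | yes c≡d = ⊥-elim (c≢d c≡d)
  ... | no a≢b′ | no c≢d′ =
    Meet-reflect (punchIn-injective v _ _)
      (intersect (a≢b ∘ punchIn-injective v a b) (c≢d ∘ punchIn-injective v c d)
        (punchOut-injective (X-avoids-rest a≢b′) (X-avoids-rest c≢d′) e))

K₄-one-colour-not-intersecting : (κ : PairColouring 4 1) → ¬ ClassesIntersect κ
K₄-one-colour-not-intersecting κ intersect =
  0F1F-apart-from-2F3F (intersect (λ ()) (λ ()) (Fin1-unique (κ 0F 1F) (κ 2F 3F)))
  where
  Fin1-unique : (i j : Fin 1) → i ≡ j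
  Fin1-unique zero zero = refl
  0F1F-apart-from-2F3F : ¬ Meet {4} 0F 1F 2F 3F
  0F1F-apart-from-2F3F (inj₁ ())
  0F1F-apart-from-2F3F (inj₂ (inj₁ ()))
  0F1F-apart-from-2F3F (inj₂ (inj₂ (inj₁ ())))
  0F1F-apart-from-2F3F (inj₂ (inj₂ (inj₂ ())))

no-intersecting-PairColouring : ∀ k (κ : PairColouring (4 + k) (suc k)) →
                                ¬ ClassesIntersect κ
no-intersecting-PairColouring zero = K₄-one-colour-not-intersecting
no-intersecting-PairColouring (suc k) κ intersect
  with StarClass-exists (n<1+n (2 + k)) κ intersect
... | X , v , star =
  no-intersecting-PairColouring k
    (delete-star intersect star) (delete-star-intersect intersect star)

Disjoint-sym : ∀ {n} (G : Graph n) {e f : Edge G} → Disjoint G e f → Disjoint G f e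
Disjoint-sym G (s≢s , s≢t , t≢s , t≢t) =
  s≢s ∘ sym , t≢s ∘ sym , s≢t ∘ sym , t≢t ∘ sym

co-colouring-separates : ∀ {n k} (G : Graph n) (c : Edge G → Fin k) →
                         IsCoColouring G k 2 c →
                         ∀ {e f} → Disjoint G e f → c e ≢ c f
co-colouring-separates G c co {e} {f} e-disjoint-f ce≡cf =
  co (pair , c e , disjoint , coloured)
  where
  pair : Fin 2 → Edge G
  pair 0F = e
  pair 1F = f
  disjoint : ∀ i j → i ≢ j → Disjoint G (pair i) (pair j)
  disjoint 0F 0F 0≢0 = ⊥-elim (0≢0 refl)
  disjoint 0F 1F _   = e-disjoint-f
  disjoint 1F 0F _   = Disjoint-sym G {e} {f} e-disjoint-f
  disjoint 1F 1F 1≢1 = ⊥-elim (1≢1 refl)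
  coloured : ∀ i → c (pair i) ≡ c e
  coloured 0F = refl
  coloured 1F = sym ce≡cf

shared-endpoint⇒Meet : ∀ {n} {x a b c d : Fin n} →
                       Endpoint x a b → Endpoint x c d → Meet a b c d
shared-endpoint⇒Meet (inj₁ refl) (inj₁ refl) = inj₁ refl
shared-endpoint⇒Meet (inj₁ refl) (inj₂ refl) = inj₂ (inj₁ refl)
shared-endpoint⇒Meet (inj₂ refl) (inj₁ refl) = inj₂ (inj₂ (inj₁ refl))
shared-endpoint⇒Meet (inj₂ refl) (inj₂ refl) = inj₂ (inj₂ (inj₂ refl))

module _ {n k} (c : Edge (complete n) → Fin (suc k))
         (co : IsCoColouring (complete n) (suc k) 2 c) where

  edgeColouring : PairColouring n (suc k)
  edgeColouring a b with <-cmp a b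
  ... | tri< a<b _ _ = c (a , b , a<b , <⇒≢ a<b)
  ... | tri≈ _ _ _   = zero
  ... | tri> _ _ b<a = c (b , a , b<a , <⇒≢ b<a)

  EdgeBetween : Fin n → Fin n → Set
  EdgeBetween a b = Σ[ e ∈ Edge (complete n) ]
    c e ≡ edgeColouring a b ×
    Endpoint (src (complete n) e) a b × Endpoint (tgt (complete n) e) a b

  edgeBetween : ∀ {a b} → a ≢ b → EdgeBetween a b
  edgeBetween {a} {b} a≢b with <-cmp a b
  ... | tri< a<b _ _ = (a , b , a<b , <⇒≢ a<b) , refl , inj₁ refl , inj₂ refl
  ... | tri≈ _ a≡b _ = ⊥-elim (a≢b a≡b)
  ... | tri> _ _ b<a = (b , a , b<a , <⇒≢ b<a) , refl , inj₂ refl , inj₁ refl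

  edgeColouring-intersect : ClassesIntersect edgeColouring
  edgeColouring-intersect {a} {b} {c′} {d} a≢b c≢d e
    with (a ≟ c′) ⊎-dec ((a ≟ d) ⊎-dec ((b ≟ c′) ⊎-dec (b ≟ d)))
  ... | yes meet = meet
  ... | no ¬meet
    with edgeBetween a≢b | edgeBetween c≢d
  ... | e₁ , ce₁ , s₁ , t₁ | e₂ , ce₂ , s₂ , t₂ =
    ⊥-elim (co-colouring-separates (complete n) c co disjoint (trans ce₁ (trans e (sym ce₂))))
    where
    apart : ∀ {x y} → Endpoint x a b → Endpoint y c′ d → x ≢ y
    apart x-end y-end refl = ¬meet (shared-endpoint⇒Meet x-end y-end)
    disjoint : Disjoint (complete n) e₁ e₂
    disjoint = apart s₁ s₂ , apart s₁ t₂ , apart t₁ s₂ , apart t₁ t₂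

corollary5p16 : (k : ℕ) → ¬ HasCoColouring (complete (k + 3)) k 2
corollary5p16 zero (c , _) with c (0F , 1F , z<s , λ ())
... | ()
corollary5p16 (suc k) rewrite +-comm k 3 = λ (c , co) →
  no-intersecting-PairColouring k (edgeColouring c co) (edgeColouring-intersect c co)
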